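{- Let $n$ and $k$ be integers with $n-1>k\ge 1$, and let $G$ be a $k$-connected graph of order $n$. Then \[W(G)\le \tfrac{1}{4}\,n\Big\lfloor \frac{n+k-2}{k}\Big\rfloor\Big(2n+k-2-k\Big\lfloor \frac{n+k-2}{k}\Big\rfloor\Big).\] Moreover, this bound is sharp when $k\ge 2$ is even: equality holds for the Harary graph $H_{k,n}$ (the graph on vertices $0,1,\dots,n-1$ arranged around a circle in which each vertex is adjacent to the nearest $k/2$ vertices in each direction around the circle), which is $k$-connected of order $n$.
   Context: All graphs are finite, simple and connected. A connected graph $G$ is $k$-connected if removing any $k-1$ vertices of $G$ leaves neither a disconnected graph nor a one-vertex graph. The order of $G$ is $|V(G)|$. For vertices $x,y$, $d_G(x,y)$ is the length of a shortest $x$–$y$ path. The Wiener index of $G$ is $W(G)=\sum_{\{x,y\}\subseteq V(G)} d_G(x,y)$, the sum over all unordered pairs of distinct vertices. -}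

module Defs where

open import Data.Bool using (Bool; true; false; _∧_; _∨_; not; if_then_else_)
open import Data.Nat using (ℕ; zero; suc; _+_; _*_; _∸_; _⊓_; _≤_; _<_; ∣_-_∣; _≤?_; _<?_; >-nonZero)
open import Data.Nat.DivMod using (_/_)
open import Data.Nat.Properties using (∣-∣-comm)
open import Data.Fin using (Fin; toℕ; _≟_)
open import Data.Fin.Subset using (Subset; _∉_; ∣_∣) renaming (⊥ to ∅)
open import Data.List using (List; map; allFin)
open import Data.Bool.ListAction using (any)
open import Data.Nat.ListAction using (sum)
open import Data.Product using (_×_)
open import Relation.Nullary using (yes; no)
open import Relation.Nullary.Decidable using (⌊_⌋)
open import Relation.Binary.PropositionalEquality using (_≡_; refl; sym; cong)

record Graph (n : ℕ) : Set where
  field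
    adj    : Fin n → Fin n → Bool
    adj-sym    : ∀ x y → adj x y ≡ adj y x
    adj-irrefl : ∀ x → adj x x ≡ false
open Graph public

data WalkAvoiding {n : ℕ} (G : Graph n) (S : Subset n) : Fin n → Fin n → Set where
  here : ∀ {x} → x ∉ S → WalkAvoiding G S x x
  step : ∀ {x y z} → x ∉ S → adj G x y ≡ true → WalkAvoiding G S y z → WalkAvoiding G S x z

Connected : {n : ℕ} → Graph n → Set
Connected {n} G = ∀ (x y : Fin n) → WalkAvoiding G ∅ x y

KConnected : {n : ℕ} → Graph n → ℕ → Set
KConnected {n} G k =
  Connected G ×
  (∀ (S : Subset n) → ∣ S ∣ ≡ k ∸ 1 →
     (∀ (x y : Fin n) → x ∉ S → y ∉ S → WalkAvoiding G S x y) × (2 ≤ n ∸ ∣ S ∣))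

reach : {n : ℕ} → Graph n → ℕ → Fin n → Fin n → Bool
reach G zero    x y = ⌊ x ≟ y ⌋
reach {n} G (suc m) x y = reach G m x y ∨ any (λ z → reach G m x z ∧ adj G z y) (allFin n)

-- least m ≤ fuel with p m = true (and fuel if there is none), searching from c.
firstFrom : ℕ → ℕ → (ℕ → Bool) → ℕ
firstFrom zero    c p = c
firstFrom (suc f) c p = if p c then c else firstFrom f (suc c) p

-- d_G(x,y): the length of a shortest x–y walk (= shortest path); in a
-- connected graph on n vertices this is < n, so searching 0..n suffices.
dist : {n : ℕ} → Graph n → Fin n → Fin n → ℕ
dist {n} G x y = firstFrom n 0 (λ m → reach G m x y)

wiener : {n : ℕ} → Graph n → ℕ
wiener {n} G =
  sum (map (λ x → sum (map (λ y → if ⌊ toℕ x <? toℕ y ⌋ then dist G x y else 0) (allFin n))) (allFin n))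

quot : (n k : ℕ) → 1 ≤ k → ℕ
quot n k h = _/_ (n + k ∸ 2) k {{>-nonZero h}}

-- 4 × the right-hand side of the bound:
-- n ⌊(n+k-2)/k⌋ (2n + k - 2 - k ⌊(n+k-2)/k⌋)
fourBound : (n k : ℕ) → 1 ≤ k → ℕ
fourBound n k h = n * quot n k h * (2 * n + k ∸ 2 ∸ k * quot n k h)

-- Harary graph H_{2r,n}: vertices 0..n-1 on a circle, i ~ j iff i ≠ j and
-- their circular distance min(|i-j|, n-|i-j|) is at most r.
neqB : {n : ℕ} → Fin n → Fin n → Bool
neqB i j with i ≟ j
... | yes _ = false
... | no _  = true

neqB-sym : {n : ℕ} (i j : Fin n) → neqB i j ≡ neqB j i
neqB-sym i j with i ≟ j | j ≟ i
... | yes _ | yes _ = refl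
... | no _  | no _  = refl
... | yes p | no q  with q (sym p)
...   | ()
neqB-sym i j | no p | yes q with p (sym q)
...   | ()

neqB-irrefl : {n : ℕ} (i : Fin n) → neqB i i ≡ false
neqB-irrefl i with i ≟ i
... | yes _ = refl
... | no p with p refl
...   | ()

circDist : (n : ℕ) → ℕ → ℕ → ℕ
circDist n a b = ∣ a - b ∣ ⊓ (n ∸ ∣ a - b ∣)

circDist-sym : ∀ n a b → circDist n a b ≡ circDist n b a
circDist-sym n a b rewrite ∣-∣-comm a b = refl

harary : (r n : ℕ) → Graph n
harary r n = record
  { adj = λ i j → neqB i j ∧ ⌊ circDist n (toℕ i) (toℕ j) ≤? r ⌋
  ; adj-sym = λ i j → cong₂' (neqB-sym i j) (circDist-sym n (toℕ i) (toℕ j))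
  ; adj-irrefl = λ i → cong (λ b → b ∧ ⌊ circDist n (toℕ i) (toℕ i) ≤? r ⌋) (neqB-irrefl i)
  }
  where
  cong₂' : ∀ {a b c d} → a ≡ b → c ≡ d → (a ∧ ⌊ c ≤? r ⌋) ≡ (b ∧ ⌊ d ≤? r ⌋)
  cong₂' refl refl = refl

-- Fix a vertex v and let c_t be the number of vertices at distance > t from v, so that
-- the transmission Σ_u d(v,u) equals Σ_t c_t. In a k-connected graph every distance
-- level strictly between 0 and the eccentricity of v holds at least k vertices (fewer,
-- padded to k − 1 vertices, would separate v from a farthest vertex), so
-- c_t ≤ (n − 1) ∸ k t. Summing over v, 2 W(G) ≤ n Σ_t ((n − 1) ∸ k t), which evaluates
-- to the bound. In the Harary graph H_{2r,n} one step moves circular distance at most r,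
-- so c_t ≥ (n − 1) ∸ 2 r t and equality holds. H_{2r,n} is 2r-connected: walking round
-- the circle in jumps of at most r can only be stopped by r consecutive deleted
-- vertices, and stopping both ways round from x to y needs 2r of them.

module Submission where

open import Defs
open import Data.Bool using (Bool; true; false; T; _∧_; if_then_else_)
open import Data.Bool.ListAction using (any)
open import Data.Bool.Properties using (T-≡; ∧-zeroʳ)
open import Data.Empty using (⊥; ⊥-elim)
open import Data.Fin as Fin using (Fin; toℕ)
open import Data.Fin.Properties using (toℕ-injective; toℕ-fromℕ<; toℕ<n)
open import Data.Fin.Subset using (Subset; _∈_; _∉_; _⊆_; ∣_∣; _∪_; ⁅_⁆; inside; outside)
  renaming (_-_ to _∖_; ⊥ to ∅)
open import Data.Fin.Subset.Properties
  using (_∈?_; ∉⊥; ∣⊥∣≡0; x∈⁅x⁆; x∈⁅y⁆⇒x≡y; x∈p∪q⁻; x∈p∪q⁺; ∣⁅x⁆∣≡1; ∣p∣≤n; x∈p⇒∣p-x∣<∣p∣; x∈p∧x≢y⇒x∈p-y)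
open import Data.List as List using (List; []; _∷_; map; allFin; length)
open import Data.List.Properties using (map-tabulate; length-tabulate)
open import Data.List.Relation.Unary.Any.Properties using (any⁺; any⁻; tabulate⁺; tabulate⁻)
open import Data.Nat
open import Data.Nat.DivMod
  using (m<n⇒m/n≡0; m/n≡1+[m∸n]/n; _mod_; m%n<n; %-distribˡ-+; m%n%n≡m%n; m<n⇒m%n≡m; m≤n⇒[n∸m]%m≡n%m; [m+n]%n≡m%n)
open import Data.Nat.ListAction using () renaming (sum to listSum)
open import Data.Nat.Properties
open import Data.Nat.Tactic.RingSolver using (solve-∀)
open import Data.Product using (_×_; _,_; ∃; proj₁; proj₂)
open import Data.Sum using (_⊎_; inj₁; inj₂)
open import Data.Vec as Vec using (here; there)
open import Data.Vec.Properties using ([]=⇒lookup; lookup⇒[]=; lookup∘tabulate)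
open import Function using (_∘_; id)
open import Function.Bundles using (Equivalence)
open import Relation.Binary.PropositionalEquality
open import Relation.Nullary using (yes; no; ¬_)
open import Relation.Nullary.Decidable using (⌊_⌋; ¬?; decidable-stable)
open import Algebra.Properties.CommutativeMonoid.Sum +-0-commutativeMonoid
  using (sum; sum-syntax; ∑-comm; ∑-distrib-+; sum-cong-≗)

private
  variable
    n : ℕ

-- Distances

firstFrom-≤ : ∀ f c p → firstFrom f c p ≤ c + f
firstFrom-≤ zero    c p = ≤-reflexive (sym (+-identityʳ c))
firstFrom-≤ (suc f) c p with p c
... | true  = m≤m+n c (suc f)
... | false = ≤-trans (firstFrom-≤ f (suc c) p) (≤-reflexive (sym (+-suc c f)))

firstFrom-minimal : ∀ f c p m → p m ≡ true → c ≤ m → m < c + f → firstFrom f c p ≤ m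
firstFrom-minimal zero c p m pm c≤m m<c =
  ⊥-elim (<-irrefl refl (≤-trans m<c (≤-trans (≤-reflexive (+-identityʳ c)) c≤m)))
firstFrom-minimal (suc f) c p m pm c≤m m<c with p c in pc
... | true  = c≤m
... | false with m≤n⇒m<n∨m≡n c≤m
...   | inj₁ c<m  = firstFrom-minimal f (suc c) p m pm c<m (≤-trans m<c (≤-reflexive (+-suc c f)))
...   | inj₂ refl with () ← trans (sym pc) pm

firstFrom-holds : ∀ f c p → firstFrom f c p < c + f → p (firstFrom f c p) ≡ true
firstFrom-holds zero    c p lt = ⊥-elim (<-irrefl (sym (+-identityʳ c)) lt)
firstFrom-holds (suc f) c p lt with p c in pc
... | true  = pc
... | false = firstFrom-holds f (suc c) p (≤-trans lt (≤-reflexive (+-suc c f)))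

firstFrom-cong : ∀ f c p q → (∀ m → p m ≡ q m) → firstFrom f c p ≡ firstFrom f c q
firstFrom-cong zero    c p q p≗q = refl
firstFrom-cong (suc f) c p q p≗q rewrite p≗q c with q c
... | true  = refl
... | false = firstFrom-cong f (suc c) p q p≗q

any-allFin⁺ : (p : Fin n → Bool) (i : Fin n) → p i ≡ true → any p (allFin n) ≡ true
any-allFin⁺ p i pi = Equivalence.to T-≡ (any⁺ p (tabulate⁺ i (Equivalence.from T-≡ pi)))

any-allFin⁻ : (p : Fin n → Bool) → any p (allFin n) ≡ true → ∃ λ i → p i ≡ true
any-allFin⁻ {n} p h with tabulate⁻ (any⁻ p (allFin n) (Equivalence.from T-≡ h))
... | i , pi = i , Equivalence.to T-≡ pi

∧-true : ∀ {a b} → a ∧ b ≡ true → a ≡ true × b ≡ true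
∧-true {true} {true} _ = refl , refl

module _ (G : Graph n) where

  data Walk≤ : ℕ → Fin n → Fin n → Set where
    []  : ∀ {m x} → Walk≤ m x x
    _▷_ : ∀ {m x y z} → Walk≤ m x y → adj G y z ≡ true → Walk≤ (suc m) x z

  Walk≤-weaken : ∀ {m x y} → Walk≤ m x y → Walk≤ (suc m) x y
  Walk≤-weaken []       = []
  Walk≤-weaken (w ▷ xy) = Walk≤-weaken w ▷ xy

  Walk≤-cons : ∀ {m x y z} → adj G x y ≡ true → Walk≤ m y z → Walk≤ (suc m) x z
  Walk≤-cons xy []       = [] ▷ xy
  Walk≤-cons xy (w ▷ yz) = Walk≤-cons xy w ▷ yz

  Walk≤-reverse : ∀ {m x y} → Walk≤ m x y → Walk≤ m y x
  Walk≤-reverse []                     = []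
  Walk≤-reverse {y = z} (_▷_ {y = y} w yz) = Walk≤-cons (trans (adj-sym G z y) yz) (Walk≤-reverse w)

  reach-refl : ∀ m x → reach G m x x ≡ true
  reach-refl zero x with x Fin.≟ x
  ... | yes _ = refl
  ... | no x≢x = ⊥-elim (x≢x refl)
  reach-refl (suc m) x rewrite reach-refl m x = refl

  reach⇒Walk≤ : ∀ m x y → reach G m x y ≡ true → Walk≤ m x y
  reach⇒Walk≤ zero x y h with x Fin.≟ y
  reach⇒Walk≤ zero x y h | yes refl = []
  reach⇒Walk≤ zero x y () | no _
  reach⇒Walk≤ (suc m) x y h with reach G m x y in r
  ... | true  = Walk≤-weaken (reach⇒Walk≤ m x y r)
  ... | false with any-allFin⁻ (λ z → reach G m x z ∧ adj G z y) h
  ...   | z , rz = reach⇒Walk≤ m x z (proj₁ (∧-true rz)) ▷ proj₂ (∧-true rz)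

  Walk≤⇒reach : ∀ {m x y} → Walk≤ m x y → reach G m x y ≡ true
  Walk≤⇒reach {m} {x} [] = reach-refl m x
  Walk≤⇒reach {suc m} {x} {z} (_▷_ {y = y} w yz) with reach G m x z
  ... | true  = refl
  ... | false = any-allFin⁺ (λ y → reach G m x y ∧ adj G y z) y (cong₂ _∧_ (Walk≤⇒reach w) yz)

  reach-sym : ∀ m x y → reach G m x y ≡ reach G m y x
  reach-sym m x y with reach G m x y in xy | reach G m y x in yx
  ... | true  | true  = refl
  ... | false | false = refl
  ... | true  | false = trans (sym (Walk≤⇒reach (Walk≤-reverse (reach⇒Walk≤ m x y xy)))) yx
  ... | false | true  = trans (sym xy) (Walk≤⇒reach (Walk≤-reverse (reach⇒Walk≤ m y x yx)))

  dist-sym : ∀ x y → dist G x y ≡ dist G y x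
  dist-sym x y = firstFrom-cong n 0 _ _ (λ m → reach-sym m x y)

  dist-≤ : ∀ x y → dist G x y ≤ n
  dist-≤ x y = firstFrom-≤ n 0 (λ m → reach G m x y)

  dist-self : ∀ x → dist G x x ≡ 0
  dist-self x = n≤0⇒n≡0 (firstFrom-minimal n 0 _ 0 (reach-refl 0 x) z≤n (0<n x))
    where
    0<n : Fin n → 0 < n
    0<n Fin.zero    = s≤s z≤n
    0<n (Fin.suc _) = s≤s z≤n

  dist-walk : ∀ x y → dist G x y < n → Walk≤ (dist G x y) x y
  dist-walk x y lt = reach⇒Walk≤ _ x y (firstFrom-holds n 0 _ lt)

  dist-minimal : ∀ {m x y} → Walk≤ m x y → dist G x y ≤ m
  dist-minimal {m} {x} {y} w with m <? n
  ... | yes m<n = firstFrom-minimal n 0 _ m (Walk≤⇒reach w) z≤n m<n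
  ... | no  m≮n = ≤-trans (dist-≤ x y) (≮⇒≥ m≮n)

  dist-step : ∀ x y z → adj G y z ≡ true → dist G x z ≤ suc (dist G x y)
  dist-step x y z yz with dist G x y <? n
  ... | yes lt = dist-minimal (dist-walk x y lt ▷ yz)
  ... | no  ≮n = ≤-trans (dist-≤ x z) (≤-trans (≮⇒≥ ≮n) (n≤1+n _))

module _ {G : Graph n} {S : Subset n} where

  WalkAvoiding-snoc : ∀ {x y z} → WalkAvoiding G S x y → adj G y z ≡ true → z ∉ S → WalkAvoiding G S x z
  WalkAvoiding-snoc (here x∉S)       yz z∉S = step x∉S yz (here z∉S)
  WalkAvoiding-snoc (step x∉S xw w)  yz z∉S = step x∉S xw (WalkAvoiding-snoc w yz z∉S)

  WalkAvoiding-reverse : ∀ {x y} → WalkAvoiding G S x y → WalkAvoiding G S y x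
  WalkAvoiding-reverse (here x∉S) = here x∉S
  WalkAvoiding-reverse {x} (step {y = w} x∉S xw rest) =
    WalkAvoiding-snoc (WalkAvoiding-reverse rest) (trans (adj-sym G w x) xw) x∉S

  -- Distances from v change by at most one along an edge, so a walk climbing
  -- past level m meets it.
  WalkAvoiding-meets-level : ∀ v {x w} m → WalkAvoiding G S x w → dist G v x ≤ m → m < dist G v w →
                             ∃ λ y → y ∉ S × dist G v y ≡ m
  WalkAvoiding-meets-level v m (here _) x≤m m<x = ⊥-elim (<-irrefl refl (≤-<-trans x≤m m<x))
  WalkAvoiding-meets-level v {x} m (step {y = y} x∉S xy rest) x≤m m<w with dist G v x ≟ m
  ... | yes x≡m = x , x∉S , x≡m
  ... | no  x≢m = WalkAvoiding-meets-level v m rest (≤-trans (dist-step G v x y xy) (≤∧≢⇒< x≤m x≢m)) m<w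

∑-mono-≤ : {f g : Fin n → ℕ} → (∀ i → f i ≤ g i) → sum f ≤ sum g
∑-mono-≤ {zero}  f≤g = z≤n
∑-mono-≤ {suc n} f≤g = +-mono-≤ (f≤g Fin.zero) (∑-mono-≤ (f≤g ∘ Fin.suc))

∑-const : ∀ n c → ∑[ i < n ] c ≡ n * c
∑-const zero    c = refl
∑-const (suc n) c = cong (c +_) (∑-const n c)

sum-tabulate : (f : Fin n → ℕ) → listSum (List.tabulate f) ≡ sum f
sum-tabulate {zero}  f = refl
sum-tabulate {suc n} f = cong (f Fin.zero +_) (sum-tabulate (f ∘ Fin.suc))

sum-map-allFin : (f : Fin n → ℕ) → listSum (map f (allFin n)) ≡ sum f
sum-map-allFin {n} f = trans (cong listSum (map-tabulate {n = n} id f)) (sum-tabulate f)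

upperPart : (Fin n → Fin n → ℕ) → Fin n → Fin n → ℕ
upperPart d x y = if ⌊ toℕ x <? toℕ y ⌋ then d x y else 0

module _ {d : Fin n → Fin n → ℕ} (d-sym : ∀ x y → d x y ≡ d y x) (d-diag : ∀ x → d x x ≡ 0) where

  upperPart-split : ∀ x y → d x y ≡ upperPart d x y + upperPart d y x
  upperPart-split x y with toℕ x <? toℕ y | toℕ y <? toℕ x
  ... | yes x<y | yes y<x = ⊥-elim (<-asym x<y y<x)
  ... | yes _   | no  _   = sym (+-identityʳ _)
  ... | no  _   | yes _   = d-sym x y
  ... | no  x≮y | no  y≮x with toℕ-injective (≤-antisym (≮⇒≥ y≮x) (≮⇒≥ x≮y))
  ...   | refl = d-diag x

  ∑∑-symmetric : ∑[ x < n ] ∑[ y < n ] d x y ≡ 2 * ∑[ x < n ] ∑[ y < n ] upperPart d x y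
  ∑∑-symmetric = begin
    ∑[ x < n ] ∑[ y < n ] d x y
      ≡⟨ sum-cong-≗ (λ x → sum-cong-≗ (upperPart-split x)) ⟩
    ∑[ x < n ] ∑[ y < n ] (upperPart d x y + upperPart d y x)
      ≡⟨ sum-cong-≗ (λ x → ∑-distrib-+ (upperPart d x) (λ y → upperPart d y x)) ⟩
    ∑[ x < n ] (∑[ y < n ] upperPart d x y + ∑[ y < n ] upperPart d y x)
      ≡⟨ ∑-distrib-+ (λ x → ∑[ y < n ] upperPart d x y) (λ x → ∑[ y < n ] upperPart d y x) ⟩
    U + ∑[ x < n ] ∑[ y < n ] upperPart d y x
      ≡⟨ cong (U +_) (∑-comm (λ x y → upperPart d y x)) ⟩
    U + U
      ≡⟨ cong (U +_) (sym (+-identityʳ U)) ⟩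
    2 * U ∎
    where
    open ≡-Reasoning
    U = ∑[ x < n ] ∑[ y < n ] upperPart d x y

profile : Graph n → Fin n → List ℕ
profile {n} G v = List.tabulate (dist G v)

transmission : Graph n → Fin n → ℕ
transmission {n} G v = ∑[ u < n ] dist G v u

∑transmission≡2*wiener : (G : Graph n) → ∑[ v < n ] transmission G v ≡ 2 * wiener G
∑transmission≡2*wiener {n} G = begin
  ∑[ v < n ] transmission G v              ≡⟨ ∑∑-symmetric (dist-sym G) (dist-self G) ⟩
  2 * ∑[ x < n ] ∑[ y < n ] upperPart (dist G) x y ≡⟨ cong (2 *_) (sym wiener≡) ⟩
  2 * wiener G ∎
  where
  open ≡-Reasoning
  wiener≡ : wiener G ≡ ∑[ x < n ] ∑[ y < n ] upperPart (dist G) x y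
  wiener≡ = trans (sum-map-allFin {n} _) (sum-cong-≗ {n} (λ x → sum-map-allFin {n} _))

-- Distance profiles

count : (ℕ → Bool) → List ℕ → ℕ
count p []       = 0
count p (x ∷ xs) = if p x then suc (count p xs) else count p xs

shiftDown : List ℕ → List ℕ
shiftDown []       = []
shiftDown (zero  ∷ xs) = shiftDown xs
shiftDown (suc x ∷ xs) = x ∷ shiftDown xs

-- tailSum k f m = Σ_{t<f} (m ∸ k t). A list sums to Σ_t #{entries > t}, and shiftDown
-- removes the term t = 0, so bounding these counts by m ∸ k t bounds the sum.
tailSum : ℕ → ℕ → ℕ → ℕ
tailSum k zero    m = 0
tailSum k (suc f) m = m + tailSum k f (m ∸ k)

tailSum-monoʳ-≤ : ∀ k f {m m′} → m ≤ m′ → tailSum k f m ≤ tailSum k f m′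
tailSum-monoʳ-≤ k zero    m≤m′ = z≤n
tailSum-monoʳ-≤ k (suc f) m≤m′ = +-mono-≤ m≤m′ (tailSum-monoʳ-≤ k f (∸-monoˡ-≤ k m≤m′))

tailSum-zero : ∀ k f → tailSum k f 0 ≡ 0
tailSum-zero k zero    = refl
tailSum-zero k (suc f) rewrite 0∸n≡0 k = tailSum-zero k f

sum-shiftDown : ∀ xs → listSum xs ≡ listSum (shiftDown xs) + length (shiftDown xs)
sum-shiftDown []           = refl
sum-shiftDown (zero  ∷ xs) = sum-shiftDown xs
sum-shiftDown (suc x ∷ xs) rewrite sum-shiftDown xs =
  sym (trans (+-suc (x + listSum (shiftDown xs)) _) (cong suc (+-assoc x _ _)))

length-shiftDown : ∀ xs → length (shiftDown xs) + count (_≡ᵇ 0) xs ≡ length xs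
length-shiftDown []           = refl
length-shiftDown (zero  ∷ xs) = trans (+-suc _ _) (cong suc (length-shiftDown xs))
length-shiftDown (suc x ∷ xs) = cong suc (length-shiftDown xs)

length-shiftDown≡count-positive : ∀ xs → length (shiftDown xs) ≡ count (0 <ᵇ_) xs
length-shiftDown≡count-positive []           = refl
length-shiftDown≡count-positive (zero  ∷ xs) = length-shiftDown≡count-positive xs
length-shiftDown≡count-positive (suc x ∷ xs) = cong suc (length-shiftDown≡count-positive xs)

count->-shiftDown : ∀ t xs → count (t <ᵇ_) (shiftDown xs) ≡ count (suc t <ᵇ_) xs
count->-shiftDown t []           = refl
count->-shiftDown t (zero  ∷ xs) = count->-shiftDown t xs
count->-shiftDown t (suc x ∷ xs) with t <ᵇ x
... | true  = cong suc (count->-shiftDown t xs)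
... | false = count->-shiftDown t xs

count-≡-shiftDown : ∀ j xs → count (_≡ᵇ j) (shiftDown xs) ≡ count (_≡ᵇ suc j) xs
count-≡-shiftDown j []           = refl
count-≡-shiftDown j (zero  ∷ xs) = count-≡-shiftDown j xs
count-≡-shiftDown j (suc x ∷ xs) with x ≡ᵇ j
... | true  = cong suc (count-≡-shiftDown j xs)
... | false = count-≡-shiftDown j xs

sum≡0 : ∀ xs → count (0 <ᵇ_) xs ≡ 0 → listSum xs ≡ 0
sum≡0 []           _ = refl
sum≡0 (zero  ∷ xs) h = sum≡0 xs h

sum≤tailSum : ∀ k N c xs → count (N <ᵇ_) xs ≡ 0 →
  (0 < count (0 <ᵇ_) xs → c ≤ count (_≡ᵇ 0) xs) →
  (∀ j → 0 < count (suc j <ᵇ_) xs → k ≤ count (_≡ᵇ suc j) xs) →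
  listSum xs ≤ tailSum k N (length xs ∸ c)
sum≤tailSum k zero c xs none _ _ = ≤-reflexive (sum≡0 xs none)
sum≤tailSum k (suc N) c xs none zeros layers with count (0 <ᵇ_) xs in pos
... | zero  = ≤-trans (≤-reflexive (sum≡0 xs pos)) z≤n
... | suc _ = begin
  listSum xs                        ≡⟨ sum-shiftDown xs ⟩
  listSum ys + length ys            ≤⟨ +-monoˡ-≤ (length ys) ih ⟩
  tailSum k N (length ys ∸ k) + length ys ≡⟨ +-comm _ (length ys) ⟩
  tailSum k (suc N) (length ys)     ≤⟨ tailSum-monoʳ-≤ k (suc N) length-ys≤ ⟩
  tailSum k (suc N) (length xs ∸ c) ∎
  where
  open ≤-Reasoning
  ys = shiftDown xs
  ih : listSum ys ≤ tailSum k N (length ys ∸ k)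
  ih = sum≤tailSum k N k ys (trans (count->-shiftDown N xs) none)
    (λ p → subst (k ≤_) (sym (count-≡-shiftDown 0 xs))
             (layers 0 (subst (0 <_) (count->-shiftDown 0 xs) p)))
    (λ j p → subst (k ≤_) (sym (count-≡-shiftDown (suc j) xs))
               (layers (suc j) (subst (0 <_) (count->-shiftDown (suc j) xs) p)))
  length-ys≤ : length ys ≤ length xs ∸ c
  length-ys≤ = begin
    length ys                                 ≡⟨ sym (m+n∸n≡m (length ys) (count (_≡ᵇ 0) xs)) ⟩
    length ys + count (_≡ᵇ 0) xs ∸ count (_≡ᵇ 0) xs ≡⟨ cong (_∸ count (_≡ᵇ 0) xs) (length-shiftDown xs) ⟩
    length xs ∸ count (_≡ᵇ 0) xs              ≤⟨ ∸-monoʳ-≤ (length xs) (zeros (s≤s z≤n)) ⟩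
    length xs ∸ c                             ∎

tailSum≤sum : ∀ k f m xs → (∀ t → m ∸ k * t ≤ count (t <ᵇ_) xs) → tailSum k f m ≤ listSum xs
tailSum≤sum k zero    m xs beyond = z≤n
tailSum≤sum k (suc f) m xs beyond = begin
  m + tailSum k f (m ∸ k) ≤⟨ +-mono-≤ m≤ ih ⟩
  length ys + listSum ys  ≡⟨ +-comm (length ys) (listSum ys) ⟩
  listSum ys + length ys  ≡⟨ sym (sum-shiftDown xs) ⟩
  listSum xs              ∎
  where
  open ≤-Reasoning
  ys = shiftDown xs
  m≤ : m ≤ length ys
  m≤ = subst₂ _≤_ (cong (m ∸_) (*-zeroʳ k)) (sym (length-shiftDown≡count-positive xs)) (beyond 0)
  ih : tailSum k f (m ∸ k) ≤ listSum ys
  ih = tailSum≤sum k f (m ∸ k) ys (λ t →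
         subst₂ _≤_ (trans (cong (m ∸_) (*-suc k t)) (sym (∸-+-assoc m k (k * t))))
                    (sym (count->-shiftDown t xs)) (beyond (suc t)))

module _ (p : ℕ → Bool) where

  count-tabulate≡0 : (g : Fin n → ℕ) → (∀ i → ¬ T (p (g i))) → count p (List.tabulate g) ≡ 0
  count-tabulate≡0 {zero}  g none = refl
  count-tabulate≡0 {suc n} g none with p (g Fin.zero) | none Fin.zero
  ... | true  | ¬p0 = ⊥-elim (¬p0 _)
  ... | false | _   = count-tabulate≡0 (g ∘ Fin.suc) (none ∘ Fin.suc)

  count-tabulate>0 : (g : Fin n → ℕ) (i : Fin n) → T (p (g i)) → 0 < count p (List.tabulate g)
  count-tabulate>0 g Fin.zero    pi with p (g Fin.zero)
  ... | true = s≤s z≤n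
  count-tabulate>0 g (Fin.suc i) pi with p (g Fin.zero)
  ... | true  = s≤s z≤n
  ... | false = count-tabulate>0 (g ∘ Fin.suc) i pi

  count-tabulate⁻ : (g : Fin n → ℕ) → 0 < count p (List.tabulate g) → ∃ λ i → T (p (g i))
  count-tabulate⁻ {suc n} g pos with p (g Fin.zero) in p0
  ... | true  = Fin.zero , Equivalence.from T-≡ p0
  ... | false with count-tabulate⁻ (g ∘ Fin.suc) pos
  ...   | i , pi = Fin.suc i , pi

module ClosedForm (k′ : ℕ) where

  K : ℕ
  K = suc k′

  ⌈_/K⌉ : ℕ → ℕ
  ⌈ m /K⌉ = (m + k′) / K

  ⌈0/K⌉ : ⌈ 0 /K⌉ ≡ 0
  ⌈0/K⌉ = m<n⇒m/n≡0 (n<1+n k′)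

  ⌈1+m/K⌉ : ∀ m → ⌈ suc m /K⌉ ≡ suc (m / K)
  ⌈1+m/K⌉ m = begin
    (suc m + k′) / K       ≡⟨ cong (_/ K) (sym (+-suc m k′)) ⟩
    (m + K) / K            ≡⟨ m/n≡1+[m∸n]/n (m≤n+m K m) ⟩
    suc ((m + K ∸ K) / K)  ≡⟨ cong (λ x → suc (x / K)) (m+n∸n≡m m K) ⟩
    suc (m / K)            ∎
    where open ≡-Reasoning

  ⌈m/K⌉-step : ∀ m → K ≤ m → ⌈ m /K⌉ ≡ suc ⌈ m ∸ K /K⌉
  ⌈m/K⌉-step m K≤m = begin
    (m + k′) / K           ≡⟨ m/n≡1+[m∸n]/n (≤-trans K≤m (m≤m+n m k′)) ⟩
    suc ((m + k′ ∸ K) / K) ≡⟨ cong (λ x → suc (x / K)) (+-∸-comm k′ K≤m) ⟩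
    suc ((m ∸ K + k′) / K) ∎
    where open ≡-Reasoning

  -- Invariant of the recursion of tailSum, stated without subtraction.
  tailSum-invariant : ∀ f m → m ≤ f → 2 * tailSum K f m + K * (⌈ m /K⌉ * ⌈ m /K⌉) ≡ ⌈ m /K⌉ * (2 * m + K)
  tailSum-invariant zero    zero    _ rewrite ⌈0/K⌉ | *-zeroʳ k′ = refl
  tailSum-invariant (suc f) zero    _ = tailSum-invariant f zero z≤n
  tailSum-invariant (suc f) (suc m) (s≤s m≤f) with suc m ≤? K
  ... | yes 1+m≤K rewrite m≤n⇒m∸n≡0 1+m≤K | tailSum-zero K f | ⌈1+m/K⌉ m | m<n⇒m/n≡0 1+m≤K =
    base K (suc m)
    where
    base : ∀ K m → 2 * (m + 0) + K * (1 * 1) ≡ 1 * (2 * m + K)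
    base = solve-∀
  ... | no  1+m≰K rewrite ⌈m/K⌉-step (suc m) (<⇒≤ (≰⇒> 1+m≰K)) =
    subst (λ x → 2 * (x + tailSum K f m′) + K * (suc q * suc q) ≡ suc q * (2 * x + K))
          (m∸n+n≡m K≤1+m)
          (begin
      2 * (m′ + K + tailSum K f m′) + K * (suc q * suc q)        ≡⟨ expand K m′ (tailSum K f m′) q ⟩
      (2 * tailSum K f m′ + K * (q * q)) + (2 * m′ + 3 * K + 2 * K * q)
        ≡⟨ cong (_+ (2 * m′ + 3 * K + 2 * K * q)) (tailSum-invariant f m′ m′≤f) ⟩
      q * (2 * m′ + K) + (2 * m′ + 3 * K + 2 * K * q)           ≡⟨ collect K m′ q ⟩
      suc q * (2 * (m′ + K) + K)                                 ∎)
    where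
    open ≡-Reasoning
    K≤1+m : K ≤ suc m
    K≤1+m = <⇒≤ (≰⇒> 1+m≰K)
    m′ = suc m ∸ K
    q = ⌈ m′ /K⌉
    m′≤f : m′ ≤ f
    m′≤f = ≤-trans (∸-monoʳ-≤ {1} {K} (suc m) (s≤s z≤n)) m≤f
    expand : ∀ K a B q → 2 * (a + K + B) + K * (suc q * suc q) ≡ (2 * B + K * (q * q)) + (2 * a + 3 * K + 2 * K * q)
    expand = solve-∀
    collect : ∀ K a q → q * (2 * a + K) + (2 * a + 3 * K + 2 * K * q) ≡ suc q * (2 * (a + K) + K)
    collect = solve-∀

  2*tailSum : ∀ m → 2 * tailSum K (suc m) m ≡ ⌈ m /K⌉ * (2 * m + K ∸ K * ⌈ m /K⌉)
  2*tailSum m = begin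
    2 * tailSum K (suc m) m                         ≡⟨ sym (m+n∸n≡m _ (K * (q * q))) ⟩
    2 * tailSum K (suc m) m + K * (q * q) ∸ K * (q * q) ≡⟨ cong (_∸ K * (q * q)) (tailSum-invariant (suc m) m (n≤1+n m)) ⟩
    q * (2 * m + K) ∸ K * (q * q)                   ≡⟨ cong (q * (2 * m + K) ∸_) (swap K q) ⟩
    q * (2 * m + K) ∸ q * (K * q)                   ≡⟨ sym (*-distribˡ-∸ q _ _) ⟩
    q * (2 * m + K ∸ K * q)                         ∎
    where
    open ≡-Reasoning
    q = ⌈ m /K⌉
    swap : ∀ K q → K * (q * q) ≡ q * (K * q)
    swap = solve-∀

fourBound≡2*n*tailSum : ∀ n′ k′ →
  fourBound (suc n′) (suc k′) (s≤s z≤n) ≡ 2 * (suc n′ * tailSum (suc k′) (suc n′) n′)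
fourBound≡2*n*tailSum n′ k′ = begin
  fourBound (suc n′) K (s≤s z≤n)
    ≡⟨ cong₂ (λ a b → suc n′ * a * (b ∸ K * a)) quot≡ width≡ ⟩
  suc n′ * q * (2 * n′ + K ∸ K * q)       ≡⟨ *-assoc (suc n′) q _ ⟩
  suc n′ * (q * (2 * n′ + K ∸ K * q))     ≡⟨ cong (suc n′ *_) (sym (2*tailSum n′)) ⟩
  suc n′ * (2 * tailSum K (suc n′) n′)    ≡⟨ swap (suc n′) 2 (tailSum K (suc n′) n′) ⟩
  2 * (suc n′ * tailSum K (suc n′) n′)    ∎
  where
  open ≡-Reasoning
  open ClosedForm k′
  q = ⌈ n′ /K⌉
  quot≡ : quot (suc n′) K (s≤s z≤n) ≡ q
  quot≡ = cong (λ x → (x ∸ 1) / K) (+-suc n′ k′)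
  reassoc : ∀ n′ k′ → 2 * suc n′ + suc k′ ≡ 2 + (2 * n′ + suc k′)
  reassoc = solve-∀
  width≡ : 2 * suc n′ + K ∸ 2 ≡ 2 * n′ + K
  width≡ = cong (_∸ 2) (reassoc n′ k′)
  swap : ∀ a b c → a * (b * c) ≡ b * (a * c)
  swap = solve-∀

-- Subsets of Fin n

∣tabulate∣≡count : (p : ℕ → Bool) (g : Fin n → ℕ) → ∣ Vec.tabulate (p ∘ g) ∣ ≡ count p (List.tabulate g)
∣tabulate∣≡count {zero}  p g = refl
∣tabulate∣≡count {suc n} p g with p (g Fin.zero)
... | true  = cong suc (∣tabulate∣≡count p (g ∘ Fin.suc))
... | false = ∣tabulate∣≡count p (g ∘ Fin.suc)

∈-tabulate⁺ : (f : Fin n → Bool) {x : Fin n} → T (f x) → x ∈ Vec.tabulate f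
∈-tabulate⁺ f {x} fx = lookup⇒[]= x (Vec.tabulate f) (trans (lookup∘tabulate f x) (Equivalence.to T-≡ fx))

∈-tabulate⁻ : (f : Fin n → Bool) {x : Fin n} → x ∈ Vec.tabulate f → T (f x)
∈-tabulate⁻ f {x} x∈ = Equivalence.from T-≡ (trans (sym (lookup∘tabulate f x)) ([]=⇒lookup x∈))

∣p∪q∣≤∣p∣+∣q∣ : (p q : Subset n) → ∣ p ∪ q ∣ ≤ ∣ p ∣ + ∣ q ∣
∣p∪q∣≤∣p∣+∣q∣ Vec.[] Vec.[] = z≤n
∣p∪q∣≤∣p∣+∣q∣ (inside  Vec.∷ p) (inside  Vec.∷ q) =
  s≤s (≤-trans (∣p∪q∣≤∣p∣+∣q∣ p q) (≤-trans (n≤1+n _) (≤-reflexive (sym (+-suc _ _)))))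
∣p∪q∣≤∣p∣+∣q∣ (inside  Vec.∷ p) (outside Vec.∷ q) = s≤s (∣p∪q∣≤∣p∣+∣q∣ p q)
∣p∪q∣≤∣p∣+∣q∣ (outside Vec.∷ p) (inside  Vec.∷ q) =
  ≤-trans (s≤s (∣p∪q∣≤∣p∣+∣q∣ p q)) (≤-reflexive (sym (+-suc _ _)))
∣p∪q∣≤∣p∣+∣q∣ (outside Vec.∷ p) (outside Vec.∷ q) = ∣p∪q∣≤∣p∣+∣q∣ p q

Disjoint : Subset n → Subset n → Set
Disjoint p q = ∀ {x} → x ∈ p → x ∉ q

Disjoint-tail : ∀ {a b} {p q : Subset n} → Disjoint (a Vec.∷ p) (b Vec.∷ q) → Disjoint p q
Disjoint-tail disj x∈p x∈q = disj (there x∈p) (there x∈q)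

Disjoint⇒∣p∣+∣q∣≤n : (p q : Subset n) → Disjoint p q → ∣ p ∣ + ∣ q ∣ ≤ n
Disjoint⇒∣p∣+∣q∣≤n Vec.[] Vec.[] _ = z≤n
Disjoint⇒∣p∣+∣q∣≤n (inside  Vec.∷ p) (inside  Vec.∷ q) disj = ⊥-elim (disj here here)
Disjoint⇒∣p∣+∣q∣≤n (inside  Vec.∷ p) (outside Vec.∷ q) disj =
  s≤s (Disjoint⇒∣p∣+∣q∣≤n p q (Disjoint-tail disj))
Disjoint⇒∣p∣+∣q∣≤n (outside Vec.∷ p) (inside  Vec.∷ q) disj =
  ≤-trans (≤-reflexive (+-suc _ _)) (s≤s (Disjoint⇒∣p∣+∣q∣≤n p q (Disjoint-tail disj)))
Disjoint⇒∣p∣+∣q∣≤n (outside Vec.∷ p) (outside Vec.∷ q) disj =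
  m≤n⇒m≤1+n (Disjoint⇒∣p∣+∣q∣≤n p q (Disjoint-tail disj))

record Extension (p q : Subset n) (s : ℕ) : Set where
  constructor extension
  field
    set      : Subset n
    ⊇p       : p ⊆ set
    avoids-q : Disjoint q set
    size     : ∣ set ∣ ≡ s

Extension-inside : ∀ {a} {p q : Subset n} {s} → Extension p q s → Extension (a Vec.∷ p) (outside Vec.∷ q) (suc s)
Extension-inside (extension S p⊆S q∩S size) = extension (inside Vec.∷ S)
  (λ { here → here ; (there x∈p) → there (p⊆S x∈p) })
  (λ { (there x∈q) (there x∈S) → q∩S x∈q x∈S })
  (cong suc size)

Extension-outside : ∀ {c} {p q : Subset n} {s} → Extension p q s → Extension (outside Vec.∷ p) (c Vec.∷ q) s
Extension-outside (extension S p⊆S q∩S size) = extension (outside Vec.∷ S)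
  (λ { (there x∈p) → there (p⊆S x∈p) })
  (λ { (there x∈q) (there x∈S) → q∩S x∈q x∈S })
  size

extend : (p q : Subset n) → Disjoint p q → ∀ s → ∣ p ∣ ≤ s → s + ∣ q ∣ ≤ n → Extension p q s
extend Vec.[] Vec.[] _ zero    _ _  = extension Vec.[] (λ ()) (λ ()) refl
extend Vec.[] Vec.[] _ (suc s) _ ()
extend (inside  Vec.∷ p) (inside  Vec.∷ q) disj s _ _ = ⊥-elim (disj here here)
extend (inside  Vec.∷ p) (outside Vec.∷ q) disj (suc s) (s≤s p≤s) (s≤s s+q≤n) =
  Extension-inside (extend p q (Disjoint-tail disj) s p≤s s+q≤n)
extend (outside Vec.∷ p) (inside  Vec.∷ q) disj s p≤s s+q≤n =
  Extension-outside (extend p q (Disjoint-tail disj) s p≤s (≤-pred (≤-trans (≤-reflexive (sym (+-suc s _))) s+q≤n)))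
extend {suc n} (outside Vec.∷ p) (outside Vec.∷ q) disj s p≤s s+q≤1+n with s + ∣ q ∣ ≤? n
... | yes s+q≤n = Extension-outside (extend p q (Disjoint-tail disj) s p≤s s+q≤n)
... | no  s+q≰n with s | s+q≤1+n
...   | zero  | _ = ⊥-elim (s+q≰n (∣p∣≤n q))
...   | suc s′ | s≤s s′+q≤n = Extension-inside (extend p q (Disjoint-tail disj) s′ p≤s′ s′+q≤n)
  where
  p≤s′ : ∣ p ∣ ≤ s′
  p≤s′ = +-cancelʳ-≤ ∣ q ∣ _ _ (≤-trans (Disjoint⇒∣p∣+∣q∣≤n p q (Disjoint-tail disj)) (≮⇒≥ s+q≰n))

injective⇒≤∣S∣ : ∀ m (g : ℕ → Fin n) (S : Subset n) → (∀ {i j} → i < m → j < m → g i ≡ g j → i ≡ j) →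
                 (∀ {i} → i < m → g i ∈ S) → m ≤ ∣ S ∣
injective⇒≤∣S∣ zero    g S inj mem = z≤n
injective⇒≤∣S∣ (suc m) g S inj mem = ≤-trans
  (s≤s (injective⇒≤∣S∣ m g (S ∖ g m) (λ i<m j<m → inj (m<n⇒m<1+n i<m) (m<n⇒m<1+n j<m))
         (λ i<m → x∈p∧x≢y⇒x∈p-y (mem (m<n⇒m<1+n i<m))
                    (λ gi≡gm → <-irrefl (inj (m<n⇒m<1+n i<m) ≤-refl gi≡gm) i<m))))
  (x∈p⇒∣p-x∣<∣p∣ (mem ≤-refl))

module _ {G : Graph n} {k′ : ℕ} (kc : KConnected G (suc k′)) (k<n : suc k′ < n) where

  -- If fewer than k vertices lay at distance j+1 from v, they could be padded to
  -- a separating set of size k − 1 avoiding v and w.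
  level-size≥k : ∀ v w j → suc j < dist G v w → suc k′ ≤ count (_≡ᵇ suc j) (profile G v)
  level-size≥k v w j j+1<w with suc k′ ≤? count (_≡ᵇ suc j) (profile G v)
  ... | yes k≤level = k≤level
  ... | no  k≰level =
    let y , y∉set , y-level = WalkAvoiding-meets-level v (suc j) v⇝w (≤-trans (≤-reflexive (dist-self G v)) z≤n) j+1<w
    in ⊥-elim (y∉set (⊇p (∈-tabulate⁺ onLevel (≡⇒≡ᵇ _ _ y-level))))
    where
    onLevel : Fin n → Bool
    onLevel u = dist G v u ≡ᵇ suc j
    level = Vec.tabulate onLevel
    level⁻ : ∀ {x} → x ∈ level → dist G v x ≡ suc j
    level⁻ x∈level = ≡ᵇ⇒≡ _ _ (∈-tabulate⁻ onLevel x∈level)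
    ends = ⁅ v ⁆ ∪ ⁅ w ⁆
    level∩ends : Disjoint level ends
    level∩ends {x} x∈level x∈ends with x∈p∪q⁻ ⁅ v ⁆ ⁅ w ⁆ x∈ends
    ... | inj₁ x∈v rewrite x∈⁅y⁆⇒x≡y v x∈v with () ← trans (sym (dist-self G v)) (level⁻ x∈level)
    ... | inj₂ x∈w rewrite x∈⁅y⁆⇒x≡y w x∈w = <-irrefl (sym (level⁻ x∈level)) j+1<w
    ∣level∣≤k′ : ∣ level ∣ ≤ k′
    ∣level∣≤k′ = subst (_≤ k′) (sym (∣tabulate∣≡count (_≡ᵇ suc j) (dist G v))) (≤-pred (≰⇒> k≰level))
    k′+∣ends∣≤n : k′ + ∣ ends ∣ ≤ n
    k′+∣ends∣≤n = ≤-trans (+-monoʳ-≤ k′ (∣p∪q∣≤∣p∣+∣q∣ ⁅ v ⁆ ⁅ w ⁆))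
                    (subst (λ e → k′ + e ≤ n) (sym (cong₂ _+_ (∣⁅x⁆∣≡1 v) (∣⁅x⁆∣≡1 w)))
                       (subst (_≤ n) (+-comm 2 k′) k<n))
    open Extension (extend level ends level∩ends k′ ∣level∣≤k′ k′+∣ends∣≤n)
    v∉set = avoids-q (x∈p∪q⁺ (inj₁ (x∈⁅x⁆ v)))
    w∉set = avoids-q (x∈p∪q⁺ (inj₂ (x∈⁅x⁆ w)))
    v⇝w = proj₁ (proj₂ kc set size) v w v∉set w∉set

  transmission≤tailSum : ∀ v → transmission G v ≤ tailSum (suc k′) n (n ∸ 1)
  transmission≤tailSum v = begin
    transmission G v                            ≡⟨ sym (sum-tabulate (dist G v)) ⟩
    listSum (profile G v)                         ≤⟨ sum≤tailSum (suc k′) n 1 (profile G v) bounded zeros levels ⟩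
    tailSum (suc k′) n (length (profile G v) ∸ 1)
      ≡⟨ cong (λ L → tailSum (suc k′) n (L ∸ 1)) (length-tabulate (dist G v)) ⟩
    tailSum (suc k′) n (n ∸ 1)                  ∎
    where
    open ≤-Reasoning
    bounded = count-tabulate≡0 (n <ᵇ_) (dist G v) (λ u n<d → <⇒≱ (<ᵇ⇒< n _ n<d) (dist-≤ G v u))
    zeros = λ _ → count-tabulate>0 (_≡ᵇ 0) (dist G v) v (≡⇒≡ᵇ _ _ (dist-self G v))
    levels = λ j pos → let (w , j+1<w) = count-tabulate⁻ (suc j <ᵇ_) (dist G v) pos
                       in level-size≥k v w j (<ᵇ⇒< _ _ j+1<w)

  4*wiener≤2*n*tailSum : 4 * wiener G ≤ 2 * (n * tailSum (suc k′) n (n ∸ 1))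
  4*wiener≤2*n*tailSum = begin
    4 * wiener G                                ≡⟨ *-assoc 2 2 (wiener G) ⟩
    2 * (2 * wiener G)                          ≡⟨ cong (2 *_) (sym (∑transmission≡2*wiener G)) ⟩
    2 * ∑[ v < n ] transmission G v             ≤⟨ *-monoʳ-≤ 2 (∑-mono-≤ transmission≤tailSum) ⟩
    2 * ∑[ v < n ] tailSum (suc k′) n (n ∸ 1)   ≡⟨ cong (2 *_) (∑-const n _) ⟩
    2 * (n * tailSum (suc k′) n (n ∸ 1))        ∎
    where open ≤-Reasoning

-- Circular distance

∣m-n∣≤o : ∀ {m n o} → m ≤ o → n ≤ o → ∣ m - n ∣ ≤ o
∣m-n∣≤o {m} {n} m≤o n≤o = ≤-trans (∣m-n∣≤m⊔n m n) (⊔-lub m≤o n≤o)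

m+n+∣m-n∣≤2*o : ∀ m n o → m ≤ o → n ≤ o → m + n + ∣ m - n ∣ ≤ 2 * o
m+n+∣m-n∣≤2*o m n o m≤o n≤o with ≤-total m n
... | inj₁ m≤n rewrite m≤n⇒∣m-n∣≡n∸m m≤n = begin
  m + n + (n ∸ m)   ≡⟨ cong (_+ (n ∸ m)) (+-comm m n) ⟩
  n + m + (n ∸ m)   ≡⟨ +-assoc n m (n ∸ m) ⟩
  n + (m + (n ∸ m)) ≡⟨ cong (n +_) (m+[n∸m]≡n m≤n) ⟩
  n + n             ≤⟨ +-mono-≤ n≤o (≤-trans n≤o (≤-reflexive (sym (+-identityʳ o)))) ⟩
  2 * o             ∎
  where open ≤-Reasoning
... | inj₂ n≤m rewrite m≤n⇒∣n-m∣≡n∸m n≤m = begin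
  m + n + (m ∸ n)   ≡⟨ +-assoc m n (m ∸ n) ⟩
  m + (n + (m ∸ n)) ≡⟨ cong (m +_) (m+[n∸m]≡n n≤m) ⟩
  m + m             ≤⟨ +-mono-≤ m≤o (≤-trans m≤o (≤-reflexive (sym (+-identityʳ o)))) ⟩
  2 * o             ∎
  where open ≤-Reasoning

-- The three gaps between points of [0, p] add up to twice the spread.
∣m-n∣+∣n-o∣+∣m-o∣≤2*p : ∀ m n o p → m ≤ p → n ≤ p → o ≤ p →
                        ∣ m - n ∣ + ∣ n - o ∣ + ∣ m - o ∣ ≤ 2 * p
∣m-n∣+∣n-o∣+∣m-o∣≤2*p zero n o p _ n≤p o≤p =
  subst (_≤ 2 * p) (swap₂₃ n o ∣ n - o ∣) (m+n+∣m-n∣≤2*o n o p n≤p o≤p)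
  where swap₂₃ : ∀ a b c → a + b + c ≡ a + c + b
        swap₂₃ = solve-∀
∣m-n∣+∣n-o∣+∣m-o∣≤2*p (suc m) zero o p m≤p _ o≤p = m+n+∣m-n∣≤2*o (suc m) o p m≤p o≤p
∣m-n∣+∣n-o∣+∣m-o∣≤2*p (suc m) (suc n) zero p m≤p n≤p _ =
  subst (_≤ 2 * p) (swap₁₃ (suc m) (suc n) ∣ m - n ∣) (m+n+∣m-n∣≤2*o (suc m) (suc n) p m≤p n≤p)
  where swap₁₃ : ∀ a b c → a + b + c ≡ c + b + a
        swap₁₃ = solve-∀
∣m-n∣+∣n-o∣+∣m-o∣≤2*p (suc m) (suc n) (suc o) (suc p) (s≤s m≤p) (s≤s n≤p) (s≤s o≤p) =
  ≤-trans (∣m-n∣+∣n-o∣+∣m-o∣≤2*p m n o p m≤p n≤p o≤p) (*-monoʳ-≤ 2 (n≤1+n p))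

circDist-triangle : ∀ n a b c → a ≤ n → b ≤ n → c ≤ n → circDist n a c ≤ circDist n a b + circDist n b c
circDist-triangle n a b c a≤n b≤n c≤n = begin
  circDist n a c
    ≤⟨ ⊓-glb (⊓-glb direct forward) (⊓-glb backward around) ⟩
  ((x + y) ⊓ (x + (n ∸ y))) ⊓ (((n ∸ x) + y) ⊓ ((n ∸ x) + (n ∸ y)))
    ≡⟨ sym (cong₂ _⊓_ (+-distribˡ-⊓ x y (n ∸ y)) (+-distribˡ-⊓ (n ∸ x) y (n ∸ y))) ⟩
  (x + (y ⊓ (n ∸ y))) ⊓ ((n ∸ x) + (y ⊓ (n ∸ y)))
    ≡⟨ sym (+-distribʳ-⊓ (y ⊓ (n ∸ y)) x (n ∸ x)) ⟩
  circDist n a b + circDist n b c ∎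
  where
  open ≤-Reasoning
  x = ∣ a - b ∣
  y = ∣ b - c ∣
  z = ∣ a - c ∣
  x≤n : x ≤ n
  x≤n = ∣m-n∣≤o a≤n b≤n
  y≤n : y ≤ n
  y≤n = ∣m-n∣≤o b≤n c≤n
  -- each of the four ways of going a → b → c bounds one of z, n ∸ z
  direct : circDist n a c ≤ x + y
  direct = ≤-trans (m⊓n≤m z (n ∸ z)) (∣-∣-triangle a b c)
  forward : circDist n a c ≤ x + (n ∸ y)
  forward = ≤-trans (m⊓n≤n z (n ∸ z)) (m≤n+o⇒m∸n≤o n z (begin
    n                  ≡⟨ sym (m+[n∸m]≡n y≤n) ⟩
    y + (n ∸ y)        ≤⟨ +-monoˡ-≤ (n ∸ y) (subst (λ w → y ≤ w + z) (∣-∣-comm b a) (∣-∣-triangle b a c)) ⟩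
    x + z + (n ∸ y)    ≡⟨ rearrange x z (n ∸ y) ⟩
    z + (x + (n ∸ y))  ∎))
    where rearrange : ∀ p q r → p + q + r ≡ q + (p + r)
          rearrange = solve-∀
  backward : circDist n a c ≤ (n ∸ x) + y
  backward = ≤-trans (m⊓n≤n z (n ∸ z)) (m≤n+o⇒m∸n≤o n z (begin
    n                  ≡⟨ sym (m+[n∸m]≡n x≤n) ⟩
    x + (n ∸ x)        ≤⟨ +-monoˡ-≤ (n ∸ x) (subst (λ w → x ≤ z + w) (∣-∣-comm c b) (∣-∣-triangle a c b)) ⟩
    z + y + (n ∸ x)    ≡⟨ rearrange z y (n ∸ x) ⟩
    z + ((n ∸ x) + y)  ∎))
    where rearrange : ∀ p q r → p + q + r ≡ p + (r + q)
          rearrange = solve-∀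
  around : circDist n a c ≤ (n ∸ x) + (n ∸ y)
  around = ≤-trans (m⊓n≤m z (n ∸ z)) (+-cancelʳ-≤ (x + y) z _ (begin
    z + (x + y)                ≡⟨ +-comm z (x + y) ⟩
    x + y + z                  ≤⟨ ∣m-n∣+∣n-o∣+∣m-o∣≤2*p a b c n a≤n b≤n c≤n ⟩
    2 * n                      ≡⟨ cong (n +_) (+-identityʳ n) ⟩
    n + n                      ≡⟨ sym (cong₂ _+_ (m∸n+n≡m x≤n) (m∸n+n≡m y≤n)) ⟩
    (n ∸ x + x) + (n ∸ y + y)  ≡⟨ regroup (n ∸ x) x (n ∸ y) y ⟩
    (n ∸ x) + (n ∸ y) + (x + y) ∎))
    where regroup : ∀ p q r s → p + q + (r + s) ≡ p + r + (q + s)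
          regroup = solve-∀

[m%n+o]%n≡[m+o]%n : ∀ m o n .{{_ : NonZero n}} → (m % n + o) % n ≡ (m + o) % n
[m%n+o]%n≡[m+o]%n m o n = begin
  (m % n + o) % n         ≡⟨ %-distribˡ-+ (m % n) o n ⟩
  (m % n % n + o % n) % n ≡⟨ cong (λ w → (w + o % n) % n) (m%n%n≡m%n m n) ⟩
  (m % n + o % n) % n     ≡⟨ sym (%-distribˡ-+ m o n) ⟩
  (m + o) % n             ∎
  where open ≡-Reasoning

module Rotation (n′ : ℕ) where

  N : ℕ
  N = suc n′

  shift : Fin N → ℕ → Fin N
  shift x a = (toℕ x + a) mod N

  toℕ-shift : ∀ x a → toℕ (shift x a) ≡ (toℕ x + a) % N
  toℕ-shift x a = toℕ-fromℕ< (m%n<n (toℕ x + a) N)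

  shift-shift : ∀ x a b → shift (shift x a) b ≡ shift x (a + b)
  shift-shift x a b = toℕ-injective (begin
    toℕ (shift (shift x a) b)  ≡⟨ toℕ-shift (shift x a) b ⟩
    (toℕ (shift x a) + b) % N  ≡⟨ cong (λ w → (w + b) % N) (toℕ-shift x a) ⟩
    ((toℕ x + a) % N + b) % N  ≡⟨ [m%n+o]%n≡[m+o]%n (toℕ x + a) b N ⟩
    (toℕ x + a + b) % N        ≡⟨ cong (_% N) (+-assoc (toℕ x) a b) ⟩
    (toℕ x + (a + b)) % N      ≡⟨ sym (toℕ-shift x (a + b)) ⟩
    toℕ (shift x (a + b))      ∎)
    where open ≡-Reasoning

  shift-0 : ∀ x → shift x 0 ≡ x
  shift-0 x = toℕ-injective (trans (toℕ-shift x 0)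
                (trans (cong (_% N) (+-identityʳ (toℕ x))) (m<n⇒m%n≡m (toℕ<n x))))

  shift-N : ∀ x → shift x N ≡ x
  shift-N x = toℕ-injective (trans (toℕ-shift x N)
                (trans ([m+n]%n≡m%n (toℕ x) N) (m<n⇒m%n≡m (toℕ<n x))))

  offset : Fin N → Fin N → ℕ
  offset x y = (toℕ y + (N ∸ toℕ x)) % N

  offset<N : ∀ x y → offset x y < N
  offset<N x y = m%n<n (toℕ y + (N ∸ toℕ x)) N

  shift-offset : ∀ x y → shift x (offset x y) ≡ y
  shift-offset x y = toℕ-injective (begin
    toℕ (shift x (offset x y))            ≡⟨ toℕ-shift x (offset x y) ⟩
    (toℕ x + offset x y) % N              ≡⟨ cong (_% N) (+-comm (toℕ x) (offset x y)) ⟩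
    (offset x y + toℕ x) % N              ≡⟨ [m%n+o]%n≡[m+o]%n (toℕ y + (N ∸ toℕ x)) (toℕ x) N ⟩
    (toℕ y + (N ∸ toℕ x) + toℕ x) % N     ≡⟨ cong (_% N) (+-assoc (toℕ y) _ _) ⟩
    (toℕ y + (N ∸ toℕ x + toℕ x)) % N     ≡⟨ cong (λ w → (toℕ y + w) % N) (m∸n+n≡m (<⇒≤ (toℕ<n x))) ⟩
    (toℕ y + N) % N                       ≡⟨ [m+n]%n≡m%n (toℕ y) N ⟩
    toℕ y % N                             ≡⟨ m<n⇒m%n≡m (toℕ<n y) ⟩
    toℕ y                                 ∎)
    where open ≡-Reasoning

  offset-shift : ∀ x {a} → a < N → offset x (shift x a) ≡ a
  offset-shift x {a} a<N = begin
    (toℕ (shift x a) + (N ∸ toℕ x)) % N   ≡⟨ cong (λ w → (w + (N ∸ toℕ x)) % N) (toℕ-shift x a) ⟩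
    ((toℕ x + a) % N + (N ∸ toℕ x)) % N   ≡⟨ [m%n+o]%n≡[m+o]%n (toℕ x + a) (N ∸ toℕ x) N ⟩
    (toℕ x + a + (N ∸ toℕ x)) % N         ≡⟨ cong (_% N) (rearrange (toℕ x) a (N ∸ toℕ x)) ⟩
    (a + (toℕ x + (N ∸ toℕ x))) % N       ≡⟨ cong (λ w → (a + w) % N) (m+[n∸m]≡n (<⇒≤ (toℕ<n x))) ⟩
    (a + N) % N                           ≡⟨ [m+n]%n≡m%n a N ⟩
    a % N                                 ≡⟨ m<n⇒m%n≡m a<N ⟩
    a                                     ∎
    where
    open ≡-Reasoning
    rearrange : ∀ p q r → p + q + r ≡ q + (p + r)
    rearrange = solve-∀

  shift-injective : ∀ x {a b} → a < N → b < N → shift x a ≡ shift x b → a ≡ b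
  shift-injective x a<N b<N eq =
    trans (sym (offset-shift x a<N)) (trans (cong (offset x) eq) (offset-shift x b<N))

  circDist-wrap : ∀ {x c} → c < N → N ≤ x + c → circDist N x (x + c ∸ N) ≡ c ⊓ (N ∸ c)
  circDist-wrap {x} {c} c<N N≤x+c = begin
    ∣ x - e ∣ ⊓ (N ∸ ∣ x - e ∣)  ≡⟨ cong (λ w → w ⊓ (N ∸ w)) (trans (m≤n⇒∣n-m∣≡n∸m e≤x) x∸e≡N∸c) ⟩
    (N ∸ c) ⊓ (N ∸ (N ∸ c))    ≡⟨ cong ((N ∸ c) ⊓_) (m∸[m∸n]≡n (<⇒≤ c<N)) ⟩
    (N ∸ c) ⊓ c                ≡⟨ ⊓-comm (N ∸ c) c ⟩
    c ⊓ (N ∸ c)                ∎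
    where
    open ≡-Reasoning
    e = x + c ∸ N
    e≤x : e ≤ x
    e≤x = m≤n+o⇒m∸n≤o (x + c) N (≤-trans (+-monoʳ-≤ x (<⇒≤ c<N)) (≤-reflexive (+-comm x N)))
    N∸c+e≡x : (N ∸ c) + e ≡ x
    N∸c+e≡x = begin
      (N ∸ c) + (x + c ∸ N)  ≡⟨ sym (+-∸-assoc (N ∸ c) N≤x+c) ⟩
      (N ∸ c) + (x + c) ∸ N  ≡⟨ cong (_∸ N) (rearrange (N ∸ c) x c) ⟩
      (N ∸ c) + c + x ∸ N    ≡⟨ cong (λ w → w + x ∸ N) (m∸n+n≡m (<⇒≤ c<N)) ⟩
      N + x ∸ N              ≡⟨ m+n∸m≡n N x ⟩
      x                      ∎
      where rearrange : ∀ p q r → p + (q + r) ≡ p + r + q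
            rearrange = solve-∀
    x∸e≡N∸c : x ∸ e ≡ N ∸ c
    x∸e≡N∸c = trans (cong (_∸ e) (sym N∸c+e≡x)) (m+n∸n≡m (N ∸ c) e)

  circDist-shift : ∀ x {c} → c < N → circDist N (toℕ x) (toℕ (shift x c)) ≡ c ⊓ (N ∸ c)
  circDist-shift x {c} c<N rewrite toℕ-shift x c with toℕ x + c <? N
  ... | yes x+c<N rewrite m<n⇒m%n≡m x+c<N | ∣m-m+n∣≡n (toℕ x) c = refl
  ... | no  x+c≮N = trans (cong (circDist N (toℕ x)) wrapped) (circDist-wrap c<N (≮⇒≥ x+c≮N))
    where
    wrapped : (toℕ x + c) % N ≡ toℕ x + c ∸ N
    wrapped = trans (sym (m≤n⇒[n∸m]%m≡n%m (≮⇒≥ x+c≮N)))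
                (m<n⇒m%n≡m (+-cancelʳ-< _ _ N
                  (subst (_< N + N) (sym (m∸n+n≡m (≮⇒≥ x+c≮N))) (+-mono-< (toℕ<n x) c<N))))

  circDist-shift-shift : ∀ x {a b} → a ≤ b → b < N → circDist N (toℕ (shift x a)) (toℕ (shift x b)) ≤ b ∸ a
  circDist-shift-shift x {a} {b} a≤b b<N = begin
    circDist N (toℕ (shift x a)) (toℕ (shift x b))           ≡⟨ cong (λ y → circDist N (toℕ (shift x a)) (toℕ y)) shifts ⟨
    circDist N (toℕ (shift x a)) (toℕ (shift (shift x a) (b ∸ a)))
      ≡⟨ circDist-shift (shift x a) (≤-<-trans (m∸n≤m b a) b<N) ⟩
    (b ∸ a) ⊓ (N ∸ (b ∸ a))                                 ≤⟨ m⊓n≤m _ _ ⟩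
    b ∸ a                                                    ∎
    where
    open ≤-Reasoning
    shifts : shift (shift x a) (b ∸ a) ≡ shift x b
    shifts = trans (shift-shift x a (b ∸ a)) (cong (shift x) (m+[n∸m]≡n a≤b))

-- Harary graphs

neqB-≢ : {i j : Fin n} → i ≢ j → neqB i j ≡ true
neqB-≢ {i = i} {j} i≢j with i Fin.≟ j
... | yes i≡j = ⊥-elim (i≢j i≡j)
... | no  _   = refl

m<o∸n⇒m+n<o : ∀ {m n o} → m < o ∸ n → m + n < o
m<o∸n⇒m+n<o {m} {n} {o} m<o∸n = m≤o∸n⇒m+n≤o (suc m) n<o m<o∸n
  where n<o = <⇒≤ (m∸n≢0⇒n<m (λ o∸n≡0 → n≮0 (subst (m <_) o∸n≡0 m<o∸n)))

module Harary (n′ r′ : ℕ) where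

  open Rotation n′ public

  r : ℕ
  r = suc r′

  H : Graph N
  H = harary r N

  adj⇒circDist≤ : ∀ i j → adj H i j ≡ true → circDist N (toℕ i) (toℕ j) ≤ r
  adj⇒circDist≤ i j ij with circDist N (toℕ i) (toℕ j) ≤? r
  ... | yes near = near
  ... | no  _ with () ← trans (sym (∧-zeroʳ (neqB i j))) ij

  circDist≤⇒adj : ∀ i j → i ≢ j → circDist N (toℕ i) (toℕ j) ≤ r → adj H i j ≡ true
  circDist≤⇒adj i j i≢j near with circDist N (toℕ i) (toℕ j) ≤? r
  ... | yes _   = cong (_∧ true) (neqB-≢ i≢j)
  ... | no  far = ⊥-elim (far near)

  Walk≤⇒circDist≤ : ∀ {m x y} → Walk≤ H m x y → circDist N (toℕ x) (toℕ y) ≤ r * m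
  Walk≤⇒circDist≤ {x = x} [] rewrite ∣n-n∣≡0 (toℕ x) = z≤n
  Walk≤⇒circDist≤ {suc m} {x} {z} (_▷_ {y = y} w yz) = begin
    circDist N (toℕ x) (toℕ z)
      ≤⟨ circDist-triangle N (toℕ x) (toℕ y) (toℕ z) (<⇒≤ (toℕ<n x)) (<⇒≤ (toℕ<n y)) (<⇒≤ (toℕ<n z)) ⟩
    circDist N (toℕ x) (toℕ y) + circDist N (toℕ y) (toℕ z)
      ≤⟨ +-mono-≤ (Walk≤⇒circDist≤ w) (adj⇒circDist≤ y z yz) ⟩
    r * m + r    ≡⟨ +-comm (r * m) r ⟩
    r + r * m    ≡⟨ *-suc r m ⟨
    r * suc m    ∎
    where open ≤-Reasoning

  dist≤⇒circDist≤ : ∀ v u t → dist H v u ≤ t → circDist N (toℕ v) (toℕ u) ≤ r * t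
  dist≤⇒circDist≤ v u t d≤t with dist H v u <? N
  ... | yes d<N = ≤-trans (Walk≤⇒circDist≤ (dist-walk H v u d<N)) (*-monoʳ-≤ r d≤t)
  ... | no  d≮N = ≤-trans (≤-trans (m⊓n≤n _ _) (m∸n≤m N ∣ toℕ v - toℕ u ∣))
                    (≤-trans (≤-trans (≮⇒≥ d≮N) d≤t) (m≤n*m t r))

  -- The vertices v + R + 1, …, v + n − R − 1 with R = r t lie at circular
  -- distance > R from v, hence at graph distance > t.
  count-beyond : ∀ v t → n′ ∸ 2 * r * t ≤ count (t <ᵇ_) (profile H v)
  count-beyond v t = subst (n′ ∸ 2 * r * t ≤_) (∣tabulate∣≡count (t <ᵇ_) (dist H v))
                       (injective⇒≤∣S∣ (n′ ∸ 2 * r * t) g beyond g-injective g∈beyond)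
    where
    R = r * t
    beyond = Vec.tabulate ((t <ᵇ_) ∘ dist H v)
    g : ℕ → Fin N
    g i = shift v (suc (R + i))
    fits : ∀ {i} → i < n′ ∸ 2 * r * t → i + (R + R) < n′
    fits {i} i< = subst (λ w → i + w < n′) (double r t) (m<o∸n⇒m+n<o i<)
      where double : ∀ r t → 2 * r * t ≡ r * t + r * t
            double = solve-∀
    step<N : ∀ {i} → i < n′ ∸ 2 * r * t → suc (R + i) < N
    step<N {i} i< = s≤s (≤-<-trans (≤-reflexive (+-comm R i)) (≤-<-trans (+-monoʳ-≤ i (m≤m+n R R)) (fits i<)))
    g-injective : ∀ {i j} → i < n′ ∸ 2 * r * t → j < n′ ∸ 2 * r * t → g i ≡ g j → i ≡ j
    g-injective i< j< gi≡gj = +-cancelˡ-≡ R _ _ (suc-injective (shift-injective v (step<N i<) (step<N j<) gi≡gj))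
    g∈beyond : ∀ {i} → i < n′ ∸ 2 * r * t → g i ∈ beyond
    g∈beyond {i} i< = ∈-tabulate⁺ ((t <ᵇ_) ∘ dist H v) (<⇒<ᵇ t<dist)
      where
      R<N∸a : R < N ∸ suc (R + i)
      R<N∸a = m+n≤o⇒m≤o∸n (suc R) (subst (_≤ N) (arrange R i) (s≤s (fits i<)))
        where arrange : ∀ R i → suc (suc (i + (R + R))) ≡ suc R + suc (R + i)
              arrange = solve-∀
      t<dist : t < dist H v (g i)
      t<dist with t <? dist H v (g i)
      ... | yes t<d = t<d
      ... | no  t≮d = ⊥-elim (<⇒≱ (⊓-glb (s≤s (m≤m+n R i)) R<N∸a)
                        (subst (_≤ R) (circDist-shift v (step<N i<)) (dist≤⇒circDist≤ v (g i) t (≮⇒≥ t≮d))))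

  tailSum≤transmission : ∀ v → tailSum (2 * r) N n′ ≤ transmission H v
  tailSum≤transmission v = subst (tailSum (2 * r) N n′ ≤_) (sum-tabulate (dist H v))
    (tailSum≤sum (2 * r) N n′ (profile H v) (count-beyond v))

  adj-shift : ∀ x {a b} → a < b → b ∸ a ≤ r → b < N → adj H (shift x a) (shift x b) ≡ true
  adj-shift x a<b b∸a≤r b<N = circDist≤⇒adj _ _
    (λ eq → <-irrefl (shift-injective x (<-trans a<b b<N) b<N eq) a<b)
    (≤-trans (circDist-shift-shift x (<⇒≤ a<b) b<N) b∸a≤r)

  Blocked : Subset N → Fin N → ℕ → ℕ → Set
  Blocked S x D c = c + r < D × (∀ {i} → i < r → shift x (suc (c + i)) ∈ S)

  module _ (S : Subset N) (x : Fin N) {D : ℕ} (D<N : D < N) (y∉S : shift x D ∉ S) where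

    -- Moving clockwise in jumps of at most r, only r consecutive vertices of S can stop us.
    walk-or-blocked : ∀ f a → D ∸ a ≤ f → a ≤ D → shift x a ∉ S →
                      WalkAvoiding H S (shift x a) (shift x D) ⊎ ∃ (Blocked S x D)
    walk-or-blocked f a fuel a≤D a∉S with a + r <? D
    walk-or-blocked f a fuel a≤D a∉S | no a+r≮D with a ≟ D
    ... | yes refl = inj₁ (here a∉S)
    ... | no  a≢D  =
      inj₁ (step a∉S (adj-shift x (≤∧≢⇒< a≤D a≢D) (m≤n+o⇒m∸n≤o D a (≮⇒≥ a+r≮D)) D<N) (here y∉S))
    walk-or-blocked zero a fuel a≤D a∉S | yes a+r<D =
      ⊥-elim (<-irrefl refl (≤-<-trans (m≤m+n a r) (≤-trans a+r<D (m∸n≡0⇒m≤n (n≤0⇒n≡0 fuel)))))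
    walk-or-blocked (suc f) a fuel a≤D a∉S | yes a+r<D
      with anyUpTo? (λ i → ¬? (shift x (suc (a + i)) ∈? S)) r
    ... | no  none = inj₂ (a , a+r<D , λ i<r →
                       decidable-stable (_ ∈? S) (λ ∉S → none (_ , i<r , ∉S)))
    ... | yes (i , i<r , b∉S)
      with walk-or-blocked f (suc (a + i))
             (≤-pred (≤-trans (∸-monoʳ-< (s≤s (m≤m+n a i)) (≤-trans (+-monoʳ-< a i<r) (<⇒≤ a+r<D))) fuel))
             (≤-trans (+-monoʳ-< a i<r) (<⇒≤ a+r<D)) b∉S
    ...   | inj₂ blocked = inj₂ blocked
    ...   | inj₁ w = inj₁ (step a∉S (adj-shift x (s≤s (m≤m+n a i))
                              (m≤n+o⇒m∸n≤o (suc (a + i)) a (+-monoʳ-< a i<r))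
                              (≤-<-trans (+-monoʳ-< a i<r) (<-trans a+r<D D<N))) w)

  two-blocks⇒2r≤∣S∣ : ∀ S x {D c₁ c₂} → D < N →
                      Blocked S x D c₁ → Blocked S (shift x D) (N ∸ D) c₂ → 2 * r ≤ ∣ S ∣
  two-blocks⇒2r≤∣S∣ S x {D} {c₁} {c₂} D<N (c₁+r<D , block₁) (c₂+r<D′ , block₂) =
    injective⇒≤∣S∣ (2 * r) (shift x ∘ position) S
      (λ i< j< eq → position-injective i< j< (shift-injective x (position<N i<) (position<N j<) eq))
      member
    where
    position : ℕ → ℕ
    position i with i <? r
    ... | yes _ = suc (c₁ + i)
    ... | no  _ = D + suc (c₂ + (i ∸ r))
    first<D : ∀ {i} → i < r → suc (c₁ + i) < D
    first<D i<r = ≤-<-trans (+-monoʳ-< c₁ i<r) c₁+r<D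
    second<N : ∀ {j} → j < r → D + suc (c₂ + j) < N
    second<N {j} j<r = subst (D + suc (c₂ + j) <_) (m+[n∸m]≡n (<⇒≤ D<N))
                     (+-monoʳ-< D (≤-<-trans (+-monoʳ-< c₂ j<r) c₂+r<D′))
    i∸r<r : ∀ {i} → i < 2 * r → ¬ i < r → i ∸ r < r
    i∸r<r {i} i<2r i≮r = +-cancelʳ-< _ _ r
      (subst (_< r + r) (sym (m∸n+n≡m (≮⇒≥ i≮r))) (subst (i <_) (cong (r +_) (+-identityʳ r)) i<2r))
    position<N : ∀ {i} → i < 2 * r → position i < N
    position<N {i} i<2r with i <? r
    ... | yes i<r = <-trans (first<D i<r) D<N
    ... | no  i≮r = second<N (i∸r<r i<2r i≮r)
    position-injective : ∀ {i j} → i < 2 * r → j < 2 * r → position i ≡ position j → i ≡ j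
    position-injective {i} {j} _ _ eq with i <? r | j <? r
    ... | yes _   | yes _   = +-cancelˡ-≡ c₁ i j (suc-injective eq)
    ... | no  i≮r | no  j≮r = trans (sym (m∸n+n≡m (≮⇒≥ i≮r)))
        (trans (cong (_+ r) (+-cancelˡ-≡ c₂ _ _ (suc-injective (+-cancelˡ-≡ D _ _ eq)))) (m∸n+n≡m (≮⇒≥ j≮r)))
    ... | yes i<r | no  _   = ⊥-elim (<-irrefl eq (<-≤-trans (first<D i<r) (m≤m+n D _)))
    ... | no  _   | yes j<r = ⊥-elim (<-irrefl (sym eq) (<-≤-trans (first<D j<r) (m≤m+n D _)))
    member : ∀ {i} → i < 2 * r → shift x (position i) ∈ S
    member {i} i<2r with i <? r
    ... | yes i<r = block₁ i<r
    ... | no  i≮r = subst (_∈ S) (shift-shift x D _) (block₂ (i∸r<r i<2r i≮r))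

  module _ (S : Subset N) (∣S∣<2r : ∣ S ∣ < 2 * r) where

    WalkAvoiding-around : ∀ x {D} → D < N → D ≢ 0 → x ∉ S → shift x D ∉ S → WalkAvoiding H S x (shift x D)
    WalkAvoiding-around x {D} D<N D≢0 x∉S y∉S =
      combine (walk-or-blocked S x D<N y∉S D 0 ≤-refl z≤n (subst (_∉ S) (sym (shift-0 x)) x∉S))
              (walk-or-blocked S y D′<N (subst (_∉ S) (sym y→x) x∉S) D′ 0 ≤-refl z≤n
                 (subst (_∉ S) (sym (shift-0 y)) y∉S))
      where
      y = shift x D
      D′ = N ∸ D
      D′<N : D′ < N
      D′<N = ∸-monoʳ-< (n≢0⇒n>0 D≢0) (<⇒≤ D<N)
      y→x : shift y D′ ≡ x
      y→x = trans (shift-shift x D D′) (trans (cong (shift x) (m+[n∸m]≡n (<⇒≤ D<N))) (shift-N x))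
      combine : WalkAvoiding H S (shift x 0) y ⊎ ∃ (Blocked S x D) →
                WalkAvoiding H S (shift y 0) (shift y D′) ⊎ ∃ (Blocked S y D′) →
                WalkAvoiding H S x y
      combine (inj₁ w) _ = subst (λ z → WalkAvoiding H S z y) (shift-0 x) w
      combine (inj₂ _) (inj₁ w) = WalkAvoiding-reverse (subst₂ (WalkAvoiding H S) (shift-0 y) y→x w)
      combine (inj₂ (_ , b₁)) (inj₂ (_ , b₂)) =
        ⊥-elim (<⇒≱ ∣S∣<2r (two-blocks⇒2r≤∣S∣ S x D<N b₁ b₂))

    WalkAvoiding-harary : ∀ x y → x ∉ S → y ∉ S → WalkAvoiding H S x y
    WalkAvoiding-harary x y x∉S y∉S with x Fin.≟ y
    ... | yes refl = here x∉S
    ... | no  x≢y  = subst (WalkAvoiding H S x) (shift-offset x y)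
        (WalkAvoiding-around x (offset<N x y) offset≢0 x∉S (subst (_∉ S) (sym (shift-offset x y)) y∉S))
      where
      offset≢0 : offset x y ≢ 0
      offset≢0 D≡0 = x≢y (trans (sym (shift-0 x)) (trans (cong (shift x) (sym D≡0)) (shift-offset x y)))

  harary-KConnected : 2 * r < n′ → KConnected H (2 * r)
  harary-KConnected 2r<n′ =
    connected , λ S ∣S∣≡ → WalkAvoiding-harary S (subst (_< 2 * r) (sym ∣S∣≡) ≤-refl) , two-left S ∣S∣≡
    where
    connected : Connected H
    connected x y = WalkAvoiding-harary ∅ (subst (_< 2 * r) (sym (∣⊥∣≡0 N)) (s≤s z≤n)) x y ∉⊥ ∉⊥
    two-left : ∀ S → ∣ S ∣ ≡ 2 * r ∸ 1 → 2 ≤ N ∸ ∣ S ∣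
    two-left S ∣S∣≡ rewrite ∣S∣≡ = m+n≤o⇒m≤o∸n 2 (m≤n⇒m≤1+n 2r<n′)

  2*n*tailSum≤4*wiener : 2 * (N * tailSum (2 * r) N n′) ≤ 4 * wiener H
  2*n*tailSum≤4*wiener = begin
    2 * (N * tailSum (2 * r) N n′)          ≡⟨ cong (2 *_) (∑-const N (tailSum (2 * r) N n′)) ⟨
    2 * ∑[ v < N ] tailSum (2 * r) N n′     ≤⟨ *-monoʳ-≤ 2 (∑-mono-≤ tailSum≤transmission) ⟩
    2 * ∑[ v < N ] transmission H v         ≡⟨ cong (2 *_) (∑transmission≡2*wiener H) ⟩
    2 * (2 * wiener H)                      ≡⟨ *-assoc 2 2 (wiener H) ⟨
    4 * wiener H                            ∎
    where open ≤-Reasoning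

wiener-bound : (n k : ℕ) (hk : 1 ≤ k) → k < n ∸ 1 →
               (G : Graph n) → KConnected G k → 4 * wiener G ≤ fourBound n k hk
wiener-bound (suc n′) (suc k′) (s≤s z≤n) k<n′ G kc = begin
  4 * wiener G                                 ≤⟨ 4*wiener≤2*n*tailSum kc (m<n⇒m<1+n k<n′) ⟩
  2 * (suc n′ * tailSum (suc k′) (suc n′) n′)  ≡⟨ fourBound≡2*n*tailSum n′ k′ ⟨
  fourBound (suc n′) (suc k′) (s≤s z≤n)        ∎
  where open ≤-Reasoning

wiener-harary : (n r : ℕ) (hk : 1 ≤ 2 * r) → 2 * r < n ∸ 1 →
                KConnected (harary r n) (2 * r) × 4 * wiener (harary r n) ≡ fourBound n (2 * r) hk
wiener-harary (suc n′) (suc r′) (s≤s z≤n) 2r<n′ =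
  kc , ≤-antisym (wiener-bound (suc n′) (2 * suc r′) (s≤s z≤n) 2r<n′ H kc) (begin
    fourBound (suc n′) (2 * suc r′) (s≤s z≤n)        ≡⟨ fourBound≡2*n*tailSum n′ _ ⟩
    2 * (suc n′ * tailSum (2 * suc r′) (suc n′) n′)  ≤⟨ 2*n*tailSum≤4*wiener ⟩
    4 * wiener H                                     ∎)
  where
  open Harary n′ r′ using (H; harary-KConnected; 2*n*tailSum≤4*wiener)
  open ≤-Reasoning
  kc = harary-KConnected 2r<n′

theorem4p3 : ((n k : ℕ) (hk : 1 ≤ k) → k < n ∸ 1 →
    (G : Graph n) → KConnected G k →
    4 * wiener G ≤ fourBound n k hk)
    ×
    ((n r : ℕ) (hk : 1 ≤ 2 * r) → 2 * r < n ∸ 1 →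
    KConnected (harary r n) (2 * r) ×
    4 * wiener (harary r n) ≡ fourBound n (2 * r) hk)
theorem4p3 = wiener-bound , wiener-harary
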